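{- Let $n\ge 3$ be an integer and let $\mathcal{G}(x,1)$ be the Grundy numbers of the subtraction game with subtraction set $\{2,4n,4n+2\}$ and a one-time pass, as defined in the context. Define $P=(3,2,2,3)$, $Q=(1,0,0,1)$, $R=(1,2,0,1)$, $S=(3,0,2,3)$. Then the sequence $(\mathcal{G}(x,1))_{x=12n+9,\dots,20n+8}$ equals the concatenation $$P^{n-2}\,Q\,R\,Q^{n-2}\,P\,S,$$ where juxtaposition denotes concatenation and $X^{j}$ denotes $j$ consecutive copies of $X$.
   Context: A position is $(x,p)$ with $x\in\mathbb{Z}_{\ge0}$ the number of stones in a single pile and $p\in\{0,1\}$, where $p=1$ means the (one-time, shared) pass is still available and $p=0$ means it is not. From $(x,p)$ one may remove $s\in\{2,4n,4n+2\}$ stones with $s\le x$, moving to $(x-s,p)$; additionally, from $(x,1)$ with $x\ge 1$ one may pass, moving to $(x,0)$. The player unable to move loses. With $\operatorname{mex}(S)$ the least nonnegative integer not in $S$, the Grundy numbers are: $\mathcal{G}(x,0)=\operatorname{mex}\{\mathcal{G}(x-s,0): s\in\{2,4n,4n+2\},\ s\le x\}$, and $\mathcal{G}(x,1)=\operatorname{mex}\big(\{\mathcal{G}(x-s,1): s\in\{2,4n,4n+2\},\ s\le x\}\cup\{\mathcal{G}(x,0)\}\big)$ for $x\ge1$, $\mathcal{G}(0,1)=0$. -}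

module Defs where

open import Data.Nat using (ℕ; zero; suc; _+_; _*_; _∸_; _≤ᵇ_; _≡ᵇ_)
open import Data.Bool using (Bool; true; false; if_then_else_; _∧_)
open import Data.List using (List; []; _∷_; _++_; concat; replicate)
open import Data.Maybe using (Maybe; just; nothing)

moves : ℕ → List ℕ
moves n = 2 ∷ 4 * n ∷ 4 * n + 2 ∷ []

elem : ℕ → List ℕ → Bool
elem k []       = false
elem k (y ∷ ys) = if k ≡ᵇ y then true else elem k ys

-- mex : least natural number not in the list.
-- The search starts at k and uses fuel; since a list of length L misses some
-- value in {0..L}, fuel = length + 1 suffices.
mexFrom : ℕ → ℕ → List ℕ → ℕ
mexFrom k zero    xs = k
mexFrom k (suc f) xs = if elem k xs then mexFrom (suc k) f xs else k

len : List ℕ → ℕ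
len [] = 0
len (_ ∷ xs) = suc (len xs)

mex : List ℕ → ℕ
mex xs = mexFrom 0 (suc (len xs)) xs

-- i-th element (0-based); default 0 (never used out of range below)
idx : List ℕ → ℕ → ℕ
idx []       _       = 0
idx (y ∷ ys) zero    = y
idx (y ∷ ys) (suc i) = idx ys i

legal : ℕ → List ℕ → List ℕ
legal m []       = []
legal m (s ∷ ss) = if (1 ≤ᵇ s) ∧ (s ≤ᵇ m) then s ∷ legal m ss else legal m ss

-- values of the options from position (suc x), given the table
-- tab = [v x, v (x-1), ..., v 0]: option suc x - s sits at index s - 1.
optVals : ℕ → ℕ → List ℕ → List ℕ
optVals n x tab = go (legal (suc x) (moves n))
  where
  go : List ℕ → List ℕ
  go []       = []
  go (s ∷ ss) = idx tab (s ∸ 1) ∷ go ss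

-- tab0 n x = [G(x,0), G(x-1,0), ..., G(0,0)]
tab0 : ℕ → ℕ → List ℕ
tab0 n zero    = mex [] ∷ []
tab0 n (suc x) = mex (optVals n x (tab0 n x)) ∷ tab0 n x

G0 : ℕ → ℕ → ℕ
G0 n x = idx (tab0 n x) 0

-- tab1 n x = [G(x,1), ..., G(0,1)], with G(0,1) = 0 and the pass option
-- (x,1) → (x,0) for x ≥ 1.
tab1 : ℕ → ℕ → List ℕ
tab1 n zero    = 0 ∷ []
tab1 n (suc x) = mex (G0 n (suc x) ∷ optVals n x (tab1 n x)) ∷ tab1 n x

G1 : ℕ → ℕ → ℕ
G1 n x = idx (tab1 n x) 0

seqFrom : ℕ → ℕ → ℕ → List ℕ
seqFrom n a zero    = []
seqFrom n a (suc l) = G1 n a ∷ seqFrom n (suc a) l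

pow : List ℕ → ℕ → List ℕ
pow X j = concat (replicate j X)

P Q R S : List ℕ
P = 3 ∷ 2 ∷ 2 ∷ 3 ∷ []
Q = 1 ∷ 0 ∷ 0 ∷ 1 ∷ []
R = 1 ∷ 2 ∷ 0 ∷ 1 ∷ []
S = 3 ∷ 0 ∷ 2 ∷ 3 ∷ []

{-# OPTIONS --safe #-}
-- Write a position as x = 4 t + r with r < 4, and the group index as t = q n + j with j < n, so that
-- block q is [4 n q, 4 n (q + 1)). All moves are even and 4 n, 4 n + 2 reach back exactly one
-- block, so the pairs (𝒢(x,0), 𝒢(x,1)) on group t are a fixed function of those on the groups
-- t - 1, t - n and t - n - 1. In each of the blocks 0, …, 5 the values on a group do not depend on j
-- once j ≥ 2 (j ≥ 3 at one position of block 3), so every block is pinned down by evaluating this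
-- function on three rows and an induction along j. The claimed sequence is blocks 3 to 5 read
-- from the second position of group 2 of block 3.
module Submission where

open import Defs
open import Data.Nat using (ℕ; zero; suc; _≤_; _<_; _+_; _*_; _∸_; _≤ᵇ_; s≤s; z≤n; z<s)
open import Data.Nat.Properties
  using ( ≤⇒≤ᵇ; ≤ᵇ⇒≤; <⇒≱; <⇒≤; ≤-pred; ≤-refl; ≤-trans; m≤m+n; m≤n⇒m<n∨m≡n
        ; +-assoc; +-comm; +-suc; suc-injective; +-monoˡ-<; +-monoʳ-<; *-monoˡ-≤; *-monoʳ-≤; *-comm; *-distribʳ-+
        ; module ≤-Reasoning )
open import Data.Nat.Tactic.RingSolver using (solve-∀)
open import Data.Bool using (true; false)
open import Data.Bool.Properties using (T-≡; ¬-not)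
open import Data.List using (List; []; _∷_; _++_; map)
open import Data.List.Properties using (map-∘; ++-assoc)
open import Data.Vec using (Vec; []; _∷_; zip)
open import Data.Product using (_×_; _,_; proj₁; proj₂)
open import Data.Sum using (inj₁; inj₂)
open import Function.Bundles using (Equivalence)
open import Relation.Binary.PropositionalEquality using (_≡_; refl; sym; trans; cong; cong₂; subst; module ≡-Reasoning)

Tabulates : (ℕ → ℕ) → List ℕ → ℕ → Set
Tabulates v t x = ∀ i {m} → i + m ≡ x → idx t i ≡ v m

tab0-tabulates : ∀ n x → Tabulates (G0 n) (tab0 n x) x
tab0-tabulates n _ zero    refl = refl
tab0-tabulates n _ (suc i) refl = tab0-tabulates n _ i refl

tab1-tabulates : ∀ n x → Tabulates (G1 n) (tab1 n x) x
tab1-tabulates n _ zero    refl = refl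
tab1-tabulates n _ (suc i) refl = tab1-tabulates n _ i refl

≤ᵇ-true : ∀ {m n} → m ≤ n → (m ≤ᵇ n) ≡ true
≤ᵇ-true m≤n = Equivalence.to T-≡ (≤⇒≤ᵇ m≤n)

≤ᵇ-false : ∀ {m n} → n < m → (m ≤ᵇ n) ≡ false
≤ᵇ-false {m} {n} n<m = ¬-not (λ m≤ᵇn → <⇒≱ n<m (≤ᵇ⇒≤ m n (Equivalence.from T-≡ m≤ᵇn)))

Options : ℕ → ℕ → List ℕ → Set
Options n x os = ∀ {v t} → Tabulates v t x → optVals n x t ≡ map v os

1<4*[1+m] : ∀ m → 1 < 4 * suc m
1<4*[1+m] m = ≤-trans (s≤s (s≤s z≤n)) (*-monoʳ-≤ 4 (s≤s (z≤n {m})))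

options-none : ∀ {m} → Options (suc m) 0 []
options-none {m} _
  rewrite ≤ᵇ-false (1<4*[1+m] m)
        | ≤ᵇ-false (≤-trans (1<4*[1+m] m) (m≤m+n (4 * suc m) 2))
  = refl

options-one : ∀ {m x a} → suc x ≡ 2 + a → suc x < 4 * suc m → Options (suc m) x (a ∷ [])
options-one {m} {x} {a} e lt tab
  rewrite ≤ᵇ-true (subst (2 ≤_) (sym e) (m≤m+n 2 a))
        | ≤ᵇ-false lt
        | ≤ᵇ-false (≤-trans lt (m≤m+n (4 * suc m) 2))
  = cong (_∷ []) (tab 1 (suc-injective (sym e)))

options-two : ∀ {m x a b} → suc x ≡ 2 + a → suc x ≡ 4 * suc m + b → b < 2 →
              Options (suc m) x (a ∷ b ∷ [])
options-two {m} {x} {a} {b} e₁ e₂ b<2 tab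
  rewrite ≤ᵇ-true (subst (2 ≤_) (sym e₁) (m≤m+n 2 a))
        | ≤ᵇ-true (subst (4 * suc m ≤_) (sym e₂) (m≤m+n (4 * suc m) b))
        | ≤ᵇ-false (subst (_< 4 * suc m + 2) (sym e₂) (+-monoʳ-< (4 * suc m) b<2))
  = cong₂ _∷_ (tab 1 (suc-injective (sym e₁))) (cong (_∷ []) (tab _ (suc-injective (sym e₂))))

options-three : ∀ {m x a b c} → suc x ≡ 2 + a → suc x ≡ 4 * suc m + b → b ≡ 2 + c →
                Options (suc m) x (a ∷ b ∷ c ∷ [])
options-three {m} {x} {a} {b} {c} e₁ e₂ refl tab
  with e₃ ← trans (+-assoc (4 * suc m) 2 c) (sym e₂)
  rewrite ≤ᵇ-true (subst (2 ≤_) (sym e₁) (m≤m+n 2 a))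
        | ≤ᵇ-true (subst (4 * suc m ≤_) (sym e₂) (m≤m+n (4 * suc m) (2 + c)))
        | ≤ᵇ-true (subst (4 * suc m + 2 ≤_) e₃ (m≤m+n (4 * suc m + 2) c))
  = cong₂ _∷_ (tab 1 (suc-injective (sym e₁)))
      (cong₂ _∷_ (tab _ (suc-injective (sym e₂))) (cong (_∷ []) (tab _ (suc-injective e₃))))

-- Opaque because comparing G at two definitionally equal positions would otherwise unfold the
-- tables of Defs, which blows up.
opaque
  G : ℕ → ℕ → ℕ × ℕ
  G n x = G0 n x , G1 n x

mexPass : List (ℕ × ℕ) → ℕ × ℕ
mexPass os = g , mex (g ∷ map proj₂ os)
  where g = mex (map proj₁ os)

opaque
  unfolding G

  G-zero : ∀ n → G n 0 ≡ (0 , 0)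
  G-zero n = refl

  G-mexPass : ∀ {n x os} → Options n x os → G n (suc x) ≡ mexPass (map (G n) os)
  G-mexPass {n} {x} {os} opts = cong₂ _,_ g₀ (cong₂ (λ g gs → mex (g ∷ gs)) g₀ g₁)
    where
    g₀ : G0 n (suc x) ≡ mex (map proj₁ (map (G n) os))
    g₀ = cong mex (trans (opts (tab0-tabulates n x)) (map-∘ os))
    g₁ : optVals n x (tab1 n x) ≡ map proj₂ (map (G n) os)
    g₁ = trans (opts (tab1-tabulates n x)) (map-∘ os)

pos : ℕ → ℕ → ℕ
pos t r = r + t * 4

pos-+ : ∀ t n r → pos (t + n) r ≡ 4 * n + pos t r
pos-+ t n r = begin
  r + (t + n) * 4      ≡⟨ cong (r +_) (*-distribʳ-+ 4 t n) ⟩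
  r + (t * 4 + n * 4)  ≡⟨ +-assoc r (t * 4) (n * 4) ⟨
  r + t * 4 + n * 4    ≡⟨ +-comm (r + t * 4) (n * 4) ⟩
  n * 4 + (r + t * 4)  ≡⟨ cong (_+ (r + t * 4)) (*-comm n 4) ⟩
  4 * n + (r + t * 4)  ∎
  where open ≡-Reasoning

pos-< : ∀ {t n r} → t < n → r < 4 → pos t r < 4 * n
pos-< {t} {n} {r} t<n r<4 = begin-strict
  r + t * 4  <⟨ +-monoˡ-< (t * 4) r<4 ⟩
  suc t * 4  ≤⟨ *-monoˡ-≤ 4 t<n ⟩
  n * 4      ≡⟨ *-comm n 4 ⟩
  4 * n      ∎
  where open ≤-Reasoning

Group : Set
Group = Vec (ℕ × ℕ) 4

group : ℕ → ℕ → Group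
group n t = G n (pos t 0) ∷ G n (pos t 1) ∷ G n (pos t 2) ∷ G n (pos t 3) ∷ []

-- Position r + 2 of a group has position r of the same group among its options.
assemble : (v₀ v₁ : ℕ × ℕ) (rest₂ rest₃ : List (ℕ × ℕ)) → Group
assemble v₀ v₁ rest₂ rest₃ = v₀ ∷ v₁ ∷ mexPass (v₀ ∷ rest₂) ∷ mexPass (v₁ ∷ rest₃) ∷ []

group-assemble : ∀ n t {v₀ v₁} rest₂ rest₃ →
  G n (pos t 0) ≡ v₀ → G n (pos t 1) ≡ v₁ →
  G n (pos t 2) ≡ mexPass (G n (pos t 0) ∷ rest₂) → G n (pos t 3) ≡ mexPass (G n (pos t 1) ∷ rest₃) →
  group n t ≡ assemble v₀ v₁ rest₂ rest₃
group-assemble n t _ _ refl refl e₂ e₃ = cong₂ _∷_ refl (cong₂ _∷_ refl (cong₂ _∷_ e₂ (cong (_∷ []) e₃)))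

-- Group t from the groups t - 1, t - n and t - n - 1, when 1, 2 or 3 of the moves are legal.
mexGroup₁ : (previous : Group) → Group
mexGroup₁ (_ ∷ _ ∷ p₂ ∷ p₃ ∷ []) = assemble (mexPass (p₂ ∷ [])) (mexPass (p₃ ∷ [])) [] []

mexGroup₂ : (previous down : Group) → Group
mexGroup₂ (_ ∷ _ ∷ p₂ ∷ p₃ ∷ []) (d₀ ∷ d₁ ∷ d₂ ∷ d₃ ∷ []) =
  assemble (mexPass (p₂ ∷ d₀ ∷ [])) (mexPass (p₃ ∷ d₁ ∷ [])) (d₂ ∷ d₀ ∷ []) (d₃ ∷ d₁ ∷ [])

mexGroup₃ : (previous down downPrevious : Group) → Group
mexGroup₃ (_ ∷ _ ∷ p₂ ∷ p₃ ∷ []) (d₀ ∷ d₁ ∷ d₂ ∷ d₃ ∷ []) (_ ∷ _ ∷ f₂ ∷ f₃ ∷ []) =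
  assemble (mexPass (p₂ ∷ d₀ ∷ f₂ ∷ [])) (mexPass (p₃ ∷ d₁ ∷ f₃ ∷ [])) (d₂ ∷ d₀ ∷ []) (d₃ ∷ d₁ ∷ [])

module _ {m : ℕ} where

  private
    n : ℕ
    n = suc m

  group-mex₀ : group n 0 ≡ assemble (0 , 0) (mexPass []) [] []
  group-mex₀ = group-assemble n 0 [] []
    (G-zero n)
    (G-mexPass (options-none {m}))
    (G-mexPass (options-one {m} refl (pos-< z<s (s≤s (s≤s (s≤s z≤n))))))
    (G-mexPass (options-one {m} refl (pos-< z<s (s≤s (s≤s (s≤s (s≤s z≤n)))))))

  group-mex₁ : ∀ {t previous} → suc t < n → group n t ≡ previous → group n (suc t) ≡ mexGroup₁ previous
  group-mex₁ {t} lt refl = group-assemble n (suc t) [] []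
    (G-mexPass (options-one refl (pos-< lt (s≤s z≤n))))
    (G-mexPass (options-one refl (pos-< lt (s≤s (s≤s z≤n)))))
    (G-mexPass (options-one refl (pos-< lt (s≤s (s≤s (s≤s z≤n))))))
    (G-mexPass (options-one refl (pos-< lt (s≤s (s≤s (s≤s (s≤s z≤n)))))))

  group-mex₂ : ∀ {previous down} → group n m ≡ previous → group n 0 ≡ down → group n n ≡ mexGroup₂ previous down
  group-mex₂ refl refl = group-assemble n n (G n 2 ∷ G n 0 ∷ []) (G n 3 ∷ G n 1 ∷ [])
    (G-mexPass (options-two refl (pos-+ 0 n 0) (s≤s z≤n)))
    (G-mexPass (options-two refl (pos-+ 0 n 1) (s≤s (s≤s z≤n))))
    (G-mexPass (options-three refl (pos-+ 0 n 2) refl))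
    (G-mexPass (options-three refl (pos-+ 0 n 3) refl))

  group-mex₃ : ∀ t {previous down downPrevious} →
    group n (t + n) ≡ previous → group n (suc t) ≡ down → group n t ≡ downPrevious →
    group n (suc t + n) ≡ mexGroup₃ previous down downPrevious
  group-mex₃ t refl refl refl = group-assemble n (suc t + n)
    (G n (pos (suc t) 2) ∷ G n (pos (suc t) 0) ∷ []) (G n (pos (suc t) 3) ∷ G n (pos (suc t) 1) ∷ [])
    (G-mexPass (options-three refl (pos-+ (suc t) n 0) refl))
    (G-mexPass (options-three refl (pos-+ (suc t) n 1) refl))
    (G-mexPass (options-three refl (pos-+ (suc t) n 2) refl))
    (G-mexPass (options-three refl (pos-+ (suc t) n 3) refl))

seqG : ℕ → ℕ → ℕ → List ℕ
seqG n a zero    = []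
seqG n a (suc l) = proj₂ (G n a) ∷ seqG n (suc a) l

opaque
  unfolding G

  seqFrom-seqG : ∀ n a l → seqFrom n a l ≡ seqG n a l
  seqFrom-seqG n a zero    = refl
  seqFrom-seqG n a (suc l) = cong (G1 n a ∷_) (seqFrom-seqG n (suc a) l)

-- The theorem's blocks of four start one position into a group.
window : Group → Group → List ℕ
window (_ ∷ a ∷ b ∷ c ∷ []) (d ∷ _) = proj₂ a ∷ proj₂ b ∷ proj₂ c ∷ proj₂ d ∷ []

seqG-windows : ∀ {n X} m t l → (∀ i → i < m → window (group n (i + t)) (group n (suc i + t)) ≡ X) →
  seqG n (pos t 1) (m * 4 + l) ≡ pow X m ++ seqG n (pos (m + t) 1) l
seqG-windows zero t l _ = refl
seqG-windows {n} {X} (suc m) t l windows = begin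
  window (group n t) (group n (suc t)) ++ seqG n (pos (suc t) 1) (m * 4 + l)
    ≡⟨ cong₂ _++_ (windows 0 z<s) (seqG-windows m (suc t) l later) ⟩
  X ++ pow X m ++ seqG n (pos (m + suc t) 1) l
    ≡⟨ cong (λ s → X ++ pow X m ++ seqG n (pos s 1) l) (+-suc m t) ⟩
  X ++ pow X m ++ seqG n (pos (suc m + t) 1) l
    ≡⟨ ++-assoc X (pow X m) _ ⟨
  pow X (suc m) ++ seqG n (pos (suc m + t) 1) l ∎
  where
  open ≡-Reasoning
  later : ∀ i → i < m → window (group n (i + suc t)) (group n (suc i + suc t)) ≡ X
  later i i<m rewrite +-suc i t = windows (suc i) (s≤s i<m)

start-position : ∀ k → 12 * (3 + k) + 9 ≡ 1 + (2 + (3 + k) + (3 + k) + (3 + k)) * 4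
start-position = solve-∀

length-split : ∀ k → 8 * (3 + k) ≡ suc k * 4 + (8 + (suc k * 4 + 8))
length-split = solve-∀

module Pattern (k : ℕ) where

  N : ℕ
  N = 3 + k

  -- grp q j = j + q * N is the index of group j of block q; the recursion on q makes
  -- the group arithmetic definitional once q is a numeral.
  grp : ℕ → ℕ → ℕ
  grp zero    j = j
  grp (suc q) j = grp q j + N

  grp-suc : ∀ q j → grp q (suc j) ≡ suc (grp q j)
  grp-suc zero    j = refl
  grp-suc (suc q) j = cong (_+ N) (grp-suc q j)

  grp-wrap : ∀ q → grp (suc q) 0 ≡ suc (grp q (2 + k))
  grp-wrap zero    = refl
  grp-wrap (suc q) = cong (_+ N) (grp-wrap q)

  grp-+ : ∀ q j i → i + grp q j ≡ grp q (j + i)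
  grp-+ zero    j i = +-comm i j
  grp-+ (suc q) j i = trans (sym (+-assoc i (grp q j) N)) (cong (_+ N) (grp-+ q j i))

  G0-even G0-odd : Vec ℕ 4
  G0-even = 0 ∷ 0 ∷ 1 ∷ 1 ∷ []
  G0-odd  = 2 ∷ 2 ∷ 3 ∷ 3 ∷ []

  row₀ row₁ row₂ row₃ row₄ row₅ : ℕ → Group
  row₀ zero          = zip G0-even (0 ∷ 1 ∷ 2 ∷ 0 ∷ [])
  row₀ (suc _)       = zip G0-even (1 ∷ 1 ∷ 0 ∷ 0 ∷ [])
  row₁ zero          = zip G0-odd  (1 ∷ 3 ∷ 4 ∷ 2 ∷ [])
  row₁ (suc zero)    = zip G0-odd  (0 ∷ 3 ∷ 2 ∷ 2 ∷ [])
  row₁ (suc (suc _)) = zip G0-odd  (3 ∷ 3 ∷ 2 ∷ 2 ∷ [])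
  row₂ zero          = zip G0-even (3 ∷ 1 ∷ 0 ∷ 0 ∷ [])
  row₂ (suc zero)    = zip G0-even (1 ∷ 1 ∷ 3 ∷ 0 ∷ [])
  row₂ (suc (suc _)) = zip G0-even (1 ∷ 1 ∷ 0 ∷ 0 ∷ [])
  row₃ zero          = zip G0-odd  (1 ∷ 3 ∷ 2 ∷ 2 ∷ [])
  row₃ (suc zero)    = zip G0-odd  (3 ∷ 3 ∷ 0 ∷ 2 ∷ [])
  row₃ (suc (suc j)) = zip G0-odd  (corner j ∷ 3 ∷ 2 ∷ 2 ∷ [])
    where
    -- keeps row₃ (2 + j) a cons-cell for a variable j, as needed for j = N - 1 = 2 + k
    corner : ℕ → ℕ
    corner zero    = 4
    corner (suc _) = 3
  row₄ zero          = zip G0-even (3 ∷ 1 ∷ 0 ∷ 0 ∷ [])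
  row₄ (suc zero)    = zip G0-even (1 ∷ 1 ∷ 2 ∷ 0 ∷ [])
  row₄ (suc (suc _)) = zip G0-even (1 ∷ 1 ∷ 0 ∷ 0 ∷ [])
  row₅ zero          = zip G0-odd  (1 ∷ 3 ∷ 2 ∷ 2 ∷ [])
  row₅ (suc zero)    = zip G0-odd  (3 ∷ 3 ∷ 0 ∷ 2 ∷ [])
  row₅ (suc (suc _)) = zip G0-odd  (3 ∷ 3 ∷ 2 ∷ 2 ∷ [])

  Block : ℕ → (ℕ → Group) → Set
  Block q row = ∀ j → j < N → group N (grp q j) ≡ row j

  block-succ : ∀ q {lower row} → Block q lower → group N (grp (suc q) 0) ≡ row 0 →
               (∀ j → row (suc j) ≡ mexGroup₃ (row j) (lower (suc j)) (lower j)) → Block (suc q) row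
  block-succ _ _ first _ zero _ = first
  block-succ q {lower} {row} blockLower first step (suc j) p = begin
    group N (grp q (suc j) + N)                  ≡⟨ cong (λ t → group N (t + N)) (grp-suc q j) ⟩
    group N (suc (grp q j) + N)                  ≡⟨ group-mex₃ (grp q j) previous down (blockLower j (<⇒≤ p)) ⟩
    mexGroup₃ (row j) (lower (suc j)) (lower j)  ≡⟨ step j ⟨
    row (suc j)                                  ∎
    where
    open ≡-Reasoning
    previous : group N (grp q j + N) ≡ row j
    previous = block-succ q blockLower first step j (<⇒≤ p)
    down : group N (suc (grp q j)) ≡ lower (suc j)
    down = trans (cong (group N) (sym (grp-suc q j))) (blockLower (suc j) p)

  block-first : ∀ q {far lower} → Block q far → Block (suc q) lower →
                group N (grp (2 + q) 0) ≡ mexGroup₃ (lower (2 + k)) (lower 0) (far (2 + k))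
  block-first q {far} {lower} blockFar blockLower = begin
    group N (grp (suc q) 0 + N)          ≡⟨ cong (λ t → group N (t + N)) (grp-wrap q) ⟩
    group N (suc (grp q (2 + k)) + N)    ≡⟨ group-mex₃ (grp q (2 + k)) (blockLower (2 + k) ≤-refl) down (blockFar (2 + k) ≤-refl) ⟩
    mexGroup₃ (lower (2 + k)) (lower 0) (far (2 + k)) ∎
    where
    open ≡-Reasoning
    down : group N (suc (grp q (2 + k))) ≡ lower 0
    down = trans (cong (group N) (sym (grp-wrap q))) (blockLower 0 z<s)

  block₀ : Block 0 row₀
  block₀ zero          _ = group-mex₀
  block₀ (suc zero)    p = group-mex₁ p (block₀ 0 (<⇒≤ p))
  block₀ (suc (suc j)) p = group-mex₁ p (block₀ (suc j) (<⇒≤ p))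

  block₁ : Block 1 row₁
  block₁ = block-succ 0 block₀ (group-mex₂ (block₀ (2 + k) ≤-refl) (block₀ 0 z<s))
    λ { zero → refl ; (suc zero) → refl ; (suc (suc _)) → refl }

  block₂ : Block 2 row₂
  block₂ = block-succ 1 block₁ (block-first 0 block₀ block₁)
    λ { zero → refl ; (suc zero) → refl ; (suc (suc _)) → refl }

  block₃ : Block 3 row₃
  block₃ = block-succ 2 block₂ (block-first 1 block₁ block₂)
    λ { zero → refl ; (suc zero) → refl ; (suc (suc _)) → refl }

  block₄ : Block 4 row₄
  block₄ = block-succ 3 block₃ (block-first 2 block₂ block₃)
    λ { zero → refl ; (suc zero) → refl ; (suc (suc _)) → refl }

  block₅ : Block 5 row₅
  block₅ = block-succ 4 block₄ (block-first 3 block₃ block₄)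
    λ { zero → refl ; (suc zero) → refl ; (suc (suc _)) → refl }

  windows₃ : ∀ i → i < suc k → window (group N (grp 3 (2 + i))) (group N (suc (grp 3 (2 + i)))) ≡ P
  windows₃ i i<1+k with m≤n⇒m<n∨m≡n (≤-pred i<1+k)
  ... | inj₁ i<k  = cong₂ window (block₃ (2 + i) (s≤s (s≤s i<1+k))) (block₃ (3 + i) (s≤s (s≤s (s≤s i<k))))
  ... | inj₂ refl = cong₂ window (block₃ (2 + k) (s≤s (s≤s i<1+k))) (block₄ 0 z<s)

  windows₄ : ∀ i → i < suc k → window (group N (grp 4 (2 + i))) (group N (suc (grp 4 (2 + i)))) ≡ Q
  windows₄ i i<1+k with m≤n⇒m<n∨m≡n (≤-pred i<1+k)
  ... | inj₁ i<k  = cong₂ window (block₄ (2 + i) (s≤s (s≤s i<1+k))) (block₄ (3 + i) (s≤s (s≤s (s≤s i<k))))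
  ... | inj₂ refl = cong₂ window (block₄ (2 + k) (s≤s (s≤s i<1+k))) (block₅ 0 z<s)

  stable-run : ∀ q {X} l → (∀ i → i < suc k → window (group N (grp q (2 + i))) (group N (suc (grp q (2 + i)))) ≡ X) →
               seqG N (pos (grp q 2) 1) (suc k * 4 + l) ≡ pow X (suc k) ++ seqG N (pos (grp q N) 1) l
  stable-run q {X} l windows = begin
    seqG N (pos (grp q 2) 1) (suc k * 4 + l)
      ≡⟨ seqG-windows (suc k) (grp q 2) l shifted ⟩
    pow X (suc k) ++ seqG N (pos (suc k + grp q 2) 1) l
      ≡⟨ cong (λ t → pow X (suc k) ++ seqG N (pos t 1) l) (grp-+ q 2 (suc k)) ⟩
    pow X (suc k) ++ seqG N (pos (grp q N) 1) l ∎
    where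
    open ≡-Reasoning
    shifted : ∀ i → i < suc k → window (group N (i + grp q 2)) (group N (suc i + grp q 2)) ≡ X
    shifted i i<1+k rewrite grp-+ q 2 i = windows i i<1+k

  irregular₄ : ∀ l → seqG N (pos (grp 4 0) 1) (8 + l) ≡ Q ++ R ++ seqG N (pos (grp 4 2) 1) l
  irregular₄ l = cong₂ (λ u v → u ++ v ++ seqG N (pos (grp 4 2) 1) l)
    (cong₂ window (block₄ 0 z<s) (block₄ 1 (s≤s (s≤s z≤n))))
    (cong₂ window (block₄ 1 (s≤s (s≤s z≤n))) (block₄ 2 (s≤s (s≤s (s≤s z≤n)))))

  irregular₅ : seqG N (pos (grp 5 0) 1) 8 ≡ P ++ S
  irregular₅ = cong₂ _++_
    (cong₂ window (block₅ 0 z<s) (block₅ 1 (s≤s (s≤s z≤n))))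
    (cong₂ window (block₅ 1 (s≤s (s≤s z≤n))) (block₅ 2 (s≤s (s≤s (s≤s z≤n)))))

theorem17 : (n : ℕ) → 3 ≤ n →
    seqFrom n (12 * n + 9) (8 * n) ≡
      pow P (n ∸ 2) ++ Q ++ R ++ pow Q (n ∸ 2) ++ P ++ S
theorem17 n@(suc (suc (suc k))) (s≤s (s≤s (s≤s z≤n))) = begin
  seqFrom n (12 * n + 9) (8 * n)
    ≡⟨ seqFrom-seqG n (12 * n + 9) (8 * n) ⟩
  seqG N (12 * N + 9) (8 * N)
    ≡⟨ cong₂ (seqG N) (start-position k) (length-split k) ⟩
  seqG N (pos (grp 3 2) 1) (suc k * 4 + (8 + (suc k * 4 + 8)))
    ≡⟨ stable-run 3 (8 + (suc k * 4 + 8)) windows₃ ⟩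
  pow P (suc k) ++ seqG N (pos (grp 4 0) 1) (8 + (suc k * 4 + 8))
    ≡⟨ cong (pow P (suc k) ++_) (irregular₄ (suc k * 4 + 8)) ⟩
  pow P (suc k) ++ Q ++ R ++ seqG N (pos (grp 4 2) 1) (suc k * 4 + 8)
    ≡⟨ cong (λ s → pow P (suc k) ++ Q ++ R ++ s) (stable-run 4 8 windows₄) ⟩
  pow P (suc k) ++ Q ++ R ++ pow Q (suc k) ++ seqG N (pos (grp 5 0) 1) 8
    ≡⟨ cong (λ s → pow P (suc k) ++ Q ++ R ++ pow Q (suc k) ++ s) irregular₅ ⟩
  pow P (suc k) ++ Q ++ R ++ pow Q (suc k) ++ P ++ S ∎
  where
  open Pattern k
  open ≡-Reasoning
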